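{- Let $A_0=1$ and for $p>0$ let $A_p = (-1)^p + 2\sum_{j=0}^{\lfloor p/2\rfloor}\binom{p}{2j+1}A_{p-2j-1}$; let $B_0=1$ and for $p>0$ let $B_p = 2\sum_{j=0}^{\lfloor p/2\rfloor}\binom{p}{2j+1}B_{p-2j-1}$. For integers $p\ge 0$ and $n \ge 0$ let $\mathcal{C}_n^{(p)} = \sum_{i=0}^{n} i^p F_{n-i}$, where $i^0$ is interpreted as $1$ (also for $i=0$). Then for all integers $p \geq 0$ and $n\ge 0$, \[ \mathcal{C}_n^{(p)} \;=\; A_p F_n + B_p F_{n+1} - \sum_{k=0}^{p} \binom{p}{k} B_k\, n^{p-k}. \]
   Context: $F_n$ denotes the Fibonacci numbers: $F_0=0$, $F_1=1$, $F_n=F_{n-1}+F_{n-2}$ for $n>1$. Binomial coefficients $\binom{p}{m}$ with $m>p$ are $0$, so in the recursive definitions only terms with $2j+1\le p$ contribute. The convention $0^0=1$ is used throughout. -}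

module Defs where

open import Data.Nat as ℕ using (ℕ; zero; suc; _∸_; _≤ᵇ_; _/_)
open import Data.Nat.Combinatorics using (_C_)
open import Data.Integer as ℤ using (ℤ; +_; _+_; _*_; _-_; -_)
open import Data.Bool using (if_then_else_)

fib : ℕ → ℕ
fib zero = 0
fib (suc zero) = 1
fib (suc (suc n)) = fib (suc n) ℕ.+ fib n

sumTo : ℕ → (ℕ → ℤ) → ℤ
sumTo zero f = f 0
sumTo (suc n) f = sumTo n f + f (suc n)

sgn : ℕ → ℤ
sgn zero = + 1
sgn (suc p) = - sgn p

recSum : ℕ → (ℕ → ℤ) → ℤ
recSum p X = + 2 * sumTo (p / 2) (λ j → + (p C (2 ℕ.* j ℕ.+ 1)) * X (p ∸ (2 ℕ.* j ℕ.+ 1)))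

-- table up to index p : tab p k = X_k for k ≤ p
-- step p X computes X_{p} (p > 0) from earlier values
tabulate : (ℕ → (ℕ → ℤ) → ℤ) → ℕ → (ℕ → ℤ)
tabulate step zero k = + 1
tabulate step (suc p) k =
  if k ≤ᵇ p then tabulate step p k else step (suc p) (tabulate step p)

A : ℕ → ℤ
A p = tabulate (λ q X → sgn q + recSum q X) p p

B : ℕ → ℤ
B p = tabulate (λ q X → recSum q X) p p

Cnp : ℕ → ℕ → ℤ
Cnp p n = sumTo n (λ i → + (i ℕ.^ p ℕ.* fib (n ∸ i)))

{-# OPTIONS --safe #-}
-- With exponential generating functions, (f ⋆ g) below is the product, ones is e^x,
-- sgn is e^(-x), δ is 1 and twiceSinh is 2 sinh x. The defining recurrences say
-- A = e^(-x) + 2 sinh x · A and B = 1 + 2 sinh x · B, whence A e^x = B and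
-- B e^x = A + B - 1. Expanding (i + 1)^p binomially gives
-- C^(·)_(n+1) = F_(n+1) δ + C^(·)_n ⋆ e^x, and the right-hand side of the formula obeys
-- the same recursion in n by the two identities above, so induction on n concludes.
-- Without power series, each identity is proved coefficientwise: both sides solve
-- X = g + twiceSinh ⋆ X, whose solution is unique because twiceSinh 0 = 0.
module Submission where

open import Defs
open import Data.Nat as ℕ using (ℕ; zero; suc; _∸_; _≤_; _<_; z≤n; s≤s; z<s; _≤ᵇ_; _/_; _<?_)
import Data.Nat.Properties as ℕP
open import Data.Nat.Combinatorics using (_C_; k>n⇒nCk≡0; nCk+nC[k+1]≡[n+1]C[k+1])
open import Data.Nat.DivMod using (m≡m%n+[m/n]*n; m%n<n)
open import Data.Nat.Induction using (<-rec)
open import Data.Integer using (ℤ; +_; _+_; _*_; _-_; _^_; -_)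
import Data.Integer.Properties as ℤP
open import Data.Integer.Tactic.RingSolver using (solve-∀)
open import Data.Bool using (true; false)
open import Data.Empty using (⊥-elim)
open import Data.Sum using (inj₁; inj₂)
open import Data.Unit using (tt)
open import Function using (_∘_)
open import Relation.Nullary using (yes; no)
open import Relation.Binary.PropositionalEquality
open ≡-Reasoning

sumTo-cong : ∀ n {f g : ℕ → ℤ} → (∀ k → k ≤ n → f k ≡ g k) → sumTo n f ≡ sumTo n g
sumTo-cong zero    f≗g = f≗g 0 z≤n
sumTo-cong (suc n) f≗g =
  cong₂ _+_ (sumTo-cong n (λ k k≤n → f≗g k (ℕP.m≤n⇒m≤1+n k≤n))) (f≗g (suc n) ℕP.≤-refl)

sumTo-zero : ∀ n → sumTo n (λ _ → + 0) ≡ + 0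
sumTo-zero zero    = refl
sumTo-zero (suc n) = trans (ℤP.+-identityʳ (sumTo n (λ _ → + 0))) (sumTo-zero n)

sumTo-+ : ∀ n (f g : ℕ → ℤ) → sumTo n (λ k → f k + g k) ≡ sumTo n f + sumTo n g
sumTo-+ zero    f g = refl
sumTo-+ (suc n) f g =
  trans (cong (_+ (f (suc n) + g (suc n))) (sumTo-+ n f g))
        (interchange (sumTo n f) (sumTo n g) (f (suc n)) (g (suc n)))
  where
  interchange : ∀ a b c d → a + b + (c + d) ≡ a + c + (b + d)
  interchange = solve-∀

sumTo-- : ∀ n (f g : ℕ → ℤ) → sumTo n (λ k → f k - g k) ≡ sumTo n f - sumTo n g
sumTo-- zero    f g = refl
sumTo-- (suc n) f g =
  trans (cong (_+ (f (suc n) - g (suc n))) (sumTo-- n f g))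
        (interchange (sumTo n f) (sumTo n g) (f (suc n)) (g (suc n)))
  where
  interchange : ∀ a b c d → a - b + (c - d) ≡ a + c - (b + d)
  interchange = solve-∀

sumTo-*ˡ : ∀ n c (f : ℕ → ℤ) → sumTo n (λ k → c * f k) ≡ c * sumTo n f
sumTo-*ˡ zero    c f = refl
sumTo-*ˡ (suc n) c f =
  trans (cong (_+ c * f (suc n)) (sumTo-*ˡ n c f)) (sym (ℤP.*-distribˡ-+ c (sumTo n f) (f (suc n))))

sumTo-*ʳ : ∀ n c (f : ℕ → ℤ) → sumTo n (λ k → f k * c) ≡ sumTo n f * c
sumTo-*ʳ zero    c f = refl
sumTo-*ʳ (suc n) c f =
  trans (cong (_+ f (suc n) * c) (sumTo-*ʳ n c f)) (sym (ℤP.*-distribʳ-+ c (sumTo n f) (f (suc n))))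

sumTo-head : ∀ n (f : ℕ → ℤ) → sumTo (suc n) f ≡ f 0 + sumTo n (f ∘ suc)
sumTo-head zero    f = refl
sumTo-head (suc n) f =
  trans (cong (_+ f (suc (suc n))) (sumTo-head n f)) (ℤP.+-assoc (f 0) _ _)

sumTo-swap : ∀ n m (f : ℕ → ℕ → ℤ) →
  sumTo n (λ i → sumTo m (f i)) ≡ sumTo m (λ j → sumTo n (λ i → f i j))
sumTo-swap zero    m f = refl
sumTo-swap (suc n) m f =
  trans (cong (_+ sumTo m (f (suc n))) (sumTo-swap n m f))
        (sym (sumTo-+ m (λ j → sumTo n (λ i → f i j)) (f (suc n))))

sumTo-extend : ∀ {n} m (f : ℕ → ℤ) → n ≤ m → (∀ k → n < k → f k ≡ + 0) →
  sumTo m f ≡ sumTo n f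
sumTo-extend m f n≤m vanish with ℕP.m≤n⇒m<n∨m≡n n≤m
sumTo-extend _       f _ vanish | inj₂ refl = refl
sumTo-extend (suc m) f _ vanish | inj₁ (s≤s n≤m) =
  trans (cong₂ _+_ (sumTo-extend m f n≤m vanish) (vanish (suc m) (s≤s n≤m))) (ℤP.+-identityʳ _)

sumTo-even-odd : ∀ m (f : ℕ → ℤ) →
  sumTo (suc (2 ℕ.* m)) f ≡ sumTo m (λ j → f (2 ℕ.* j)) + sumTo m (λ j → f (suc (2 ℕ.* j)))
sumTo-even-odd zero    f = refl
sumTo-even-odd (suc m) f = begin
  sumTo (suc (2 ℕ.* suc m)) f
    ≡⟨ cong (λ t → sumTo (suc t) f) 2[1+m] ⟩
  sumTo (suc (2 ℕ.* m)) f + f (2 ℕ.+ 2 ℕ.* m) + f (3 ℕ.+ 2 ℕ.* m)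
    ≡⟨ cong (λ s → s + f (2 ℕ.+ 2 ℕ.* m) + f (3 ℕ.+ 2 ℕ.* m)) (sumTo-even-odd m f) ⟩
  E + O + f (2 ℕ.+ 2 ℕ.* m) + f (3 ℕ.+ 2 ℕ.* m)
    ≡⟨ interchange E O _ _ ⟩
  E + f (2 ℕ.+ 2 ℕ.* m) + (O + f (3 ℕ.+ 2 ℕ.* m))
    ≡⟨ cong (λ t → E + f t + (O + f (suc t))) (sym 2[1+m]) ⟩
  E + f (2 ℕ.* suc m) + (O + f (suc (2 ℕ.* suc m))) ∎
  where
  2[1+m] = ℕP.*-suc 2 m
  E = sumTo m (λ j → f (2 ℕ.* j))
  O = sumTo m (λ j → f (suc (2 ℕ.* j)))
  interchange : ∀ e o a b → e + o + a + b ≡ e + a + (o + b)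
  interchange = solve-∀

_⋆_ : (ℕ → ℤ) → (ℕ → ℤ) → ℕ → ℤ
(f ⋆ g) p = sumTo p (λ k → + (p C k) * f k * g (p ∸ k))

ones : ℕ → ℤ
ones _ = + 1

δ : ℕ → ℤ
δ zero    = + 1
δ (suc _) = + 0

⋆-congˡ : ∀ {f f' : ℕ → ℤ} (g : ℕ → ℤ) p → (∀ k → f k ≡ f' k) → (f ⋆ g) p ≡ (f' ⋆ g) p
⋆-congˡ g p f≗f' = sumTo-cong p (λ k _ → cong (λ a → + (p C k) * a * g (p ∸ k)) (f≗f' k))

⋆-congʳ : ∀ (f : ℕ → ℤ) {g g' : ℕ → ℤ} p → (∀ k → g k ≡ g' k) → (f ⋆ g) p ≡ (f ⋆ g') p
⋆-congʳ f p g≗g' = sumTo-cong p (λ k _ → cong (+ (p C k) * f k *_) (g≗g' (p ∸ k)))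

⋆-+ˡ : ∀ (f f' g : ℕ → ℤ) p → ((λ k → f k + f' k) ⋆ g) p ≡ (f ⋆ g) p + (f' ⋆ g) p
⋆-+ˡ f f' g p = trans (sumTo-cong p (λ k _ → distrib (+ (p C k)) (f k) (f' k) _)) (sumTo-+ p _ _)
  where
  distrib : ∀ c a b x → c * (a + b) * x ≡ c * a * x + c * b * x
  distrib = solve-∀

⋆-+ʳ : ∀ (f g g' : ℕ → ℤ) p → (f ⋆ (λ k → g k + g' k)) p ≡ (f ⋆ g) p + (f ⋆ g') p
⋆-+ʳ f g g' p = trans (sumTo-cong p (λ k _ → ℤP.*-distribˡ-+ (+ (p C k) * f k) _ _)) (sumTo-+ p _ _)

⋆--ˡ : ∀ (f f' g : ℕ → ℤ) p → ((λ k → f k - f' k) ⋆ g) p ≡ (f ⋆ g) p - (f' ⋆ g) p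
⋆--ˡ f f' g p = trans (sumTo-cong p (λ k _ → distrib (+ (p C k)) (f k) (f' k) _)) (sumTo-- p _ _)
  where
  distrib : ∀ c a b x → c * (a - b) * x ≡ c * a * x - c * b * x
  distrib = solve-∀

⋆--ʳ : ∀ (f g g' : ℕ → ℤ) p → (f ⋆ (λ k → g k - g' k)) p ≡ (f ⋆ g) p - (f ⋆ g') p
⋆--ʳ f g g' p = trans (sumTo-cong p (λ k _ → distrib (+ (p C k) * f k) _ _)) (sumTo-- p _ _)
  where
  distrib : ∀ c a b → c * (a - b) ≡ c * a - c * b
  distrib = solve-∀

⋆-*ˡ : ∀ c (f g : ℕ → ℤ) p → ((λ k → c * f k) ⋆ g) p ≡ c * (f ⋆ g) p
⋆-*ˡ c f g p = trans (sumTo-cong p (λ k _ → pull c (+ (p C k)) (f k) _)) (sumTo-*ˡ p c _)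
  where
  pull : ∀ c b a x → b * (c * a) * x ≡ c * (b * a * x)
  pull = solve-∀

⋆-zeroʳ : ∀ (f : ℕ → ℤ) p → (f ⋆ (λ _ → + 0)) p ≡ + 0
⋆-zeroʳ f p = trans (sumTo-cong p (λ k _ → ℤP.*-zeroʳ (+ (p C k) * f k))) (sumTo-zero p)

⋆-sumTo : ∀ n (f : ℕ → ℕ → ℤ) (g : ℕ → ℤ) p →
  ((λ m → sumTo n (λ i → f i m)) ⋆ g) p ≡ sumTo n (λ i → (f i ⋆ g) p)
⋆-sumTo n f g p = trans (sumTo-cong p (λ k _ → spread k)) (sumTo-swap p n _)
  where
  spread : ∀ k → + (p C k) * sumTo n (λ i → f i k) * g (p ∸ k)
                ≡ sumTo n (λ i → + (p C k) * f i k * g (p ∸ k))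
  spread k = trans (cong (_* g (p ∸ k)) (sym (sumTo-*ˡ n (+ (p C k)) (λ i → f i k))))
                   (sym (sumTo-*ʳ n (g (p ∸ k)) (λ i → + (p C k) * f i k)))

-- Leibniz rule: shifting a coefficient sequence is differentiating its generating function.
⋆-suc : ∀ (f g : ℕ → ℤ) q → (f ⋆ g) (suc q) ≡ ((f ∘ suc) ⋆ g) q + (f ⋆ (g ∘ suc)) q
⋆-suc f g q = begin
  (f ⋆ g) (suc q)
    ≡⟨ sumTo-head q _ ⟩
  w 0 + sumTo q (λ k → + (suc q C suc k) * f (suc k) * g (q ∸ k))
    ≡⟨ cong (_+_ (w 0)) (trans (sumTo-cong q (λ k _ → pascal k)) (sumTo-+ q _ v)) ⟩
  w 0 + (((f ∘ suc) ⋆ g) q + sumTo q v)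
    ≡⟨ rotate (w 0) (((f ∘ suc) ⋆ g) q) (sumTo q v) ⟩
  ((f ∘ suc) ⋆ g) q + (w 0 + sumTo q v)
    ≡⟨ cong (λ s → ((f ∘ suc) ⋆ g) q + (w 0 + s)) (sumTo-cong q (λ k _ → v≡w∘suc k)) ⟩
  ((f ∘ suc) ⋆ g) q + (w 0 + sumTo q (w ∘ suc))
    ≡⟨ cong (_+_ (((f ∘ suc) ⋆ g) q)) (sym (sumTo-head q w)) ⟩
  ((f ∘ suc) ⋆ g) q + (sumTo q w + w (suc q))
    ≡⟨ cong (λ t → ((f ∘ suc) ⋆ g) q + (sumTo q w + t)) w-top ⟩
  ((f ∘ suc) ⋆ g) q + (sumTo q w + + 0)
    ≡⟨ cong (_+_ (((f ∘ suc) ⋆ g) q)) (ℤP.+-identityʳ _) ⟩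
  ((f ∘ suc) ⋆ g) q + (f ⋆ (g ∘ suc)) q ∎
  where
  v w : ℕ → ℤ
  v k = + (q C suc k) * f (suc k) * g (q ∸ k)
  w k = + (q C k) * f k * g (suc (q ∸ k))
  pascal : ∀ k → + (suc q C suc k) * f (suc k) * g (q ∸ k)
                 ≡ + (q C k) * f (suc k) * g (q ∸ k) + v k
  pascal k = begin
    + (suc q C suc k) * f (suc k) * g (q ∸ k)
      ≡⟨ cong (λ c → + c * f (suc k) * g (q ∸ k)) (sym (nCk+nC[k+1]≡[n+1]C[k+1] q k)) ⟩
    + (q C k ℕ.+ q C suc k) * f (suc k) * g (q ∸ k)
      ≡⟨ cong (λ c → c * f (suc k) * g (q ∸ k)) (ℤP.pos-+ (q C k) (q C suc k)) ⟩
    (+ (q C k) + + (q C suc k)) * f (suc k) * g (q ∸ k)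
      ≡⟨ distrib (+ (q C k)) (+ (q C suc k)) (f (suc k)) (g (q ∸ k)) ⟩
    + (q C k) * f (suc k) * g (q ∸ k) + v k ∎
    where
    distrib : ∀ a b x y → (a + b) * x * y ≡ a * x * y + b * x * y
    distrib = solve-∀
  rotate : ∀ a b c → a + (b + c) ≡ b + (a + c)
  rotate = solve-∀
  -- For k = q the two sides differ in the argument of g, but then q C (k + 1) = 0.
  v≡w∘suc : ∀ k → v k ≡ w (suc k)
  v≡w∘suc k with k <? q
  ... | yes k<q = cong (λ i → + (q C suc k) * f (suc k) * g i) (ℕP.+-∸-assoc 1 k<q)
  ... | no  k≮q rewrite k>n⇒nCk≡0 (s≤s (ℕP.≮⇒≥ k≮q)) = refl
  w-top : w (suc q) ≡ + 0
  w-top rewrite k>n⇒nCk≡0 (ℕP.n<1+n q) = refl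

⋆-assoc : ∀ (f g h : ℕ → ℤ) p → ((f ⋆ g) ⋆ h) p ≡ (f ⋆ (g ⋆ h)) p
⋆-assoc f g h zero = assoc (f 0) (g 0) (h 0)
  where
  assoc : ∀ a b c → + 1 * (+ 1 * a * b) * c ≡ + 1 * a * (+ 1 * b * c)
  assoc = solve-∀
⋆-assoc f g h (suc q) = begin
  ((f ⋆ g) ⋆ h) (suc q)
    ≡⟨ ⋆-suc (f ⋆ g) h q ⟩
  (((f ⋆ g) ∘ suc) ⋆ h) q + ((f ⋆ g) ⋆ (h ∘ suc)) q
    ≡⟨ cong (_+ ((f ⋆ g) ⋆ (h ∘ suc)) q)
            (trans (⋆-congˡ h q (⋆-suc f g)) (⋆-+ˡ _ _ h q)) ⟩
  (((f ∘ suc) ⋆ g) ⋆ h) q + ((f ⋆ (g ∘ suc)) ⋆ h) q + ((f ⋆ g) ⋆ (h ∘ suc)) q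
    ≡⟨ cong₂ _+_ (cong₂ _+_ (⋆-assoc (f ∘ suc) g h q) (⋆-assoc f (g ∘ suc) h q))
                 (⋆-assoc f g (h ∘ suc) q) ⟩
  ((f ∘ suc) ⋆ (g ⋆ h)) q + (f ⋆ ((g ∘ suc) ⋆ h)) q + (f ⋆ (g ⋆ (h ∘ suc))) q
    ≡⟨ ℤP.+-assoc (((f ∘ suc) ⋆ (g ⋆ h)) q) ((f ⋆ ((g ∘ suc) ⋆ h)) q)
                   ((f ⋆ (g ⋆ (h ∘ suc))) q) ⟩
  ((f ∘ suc) ⋆ (g ⋆ h)) q + ((f ⋆ ((g ∘ suc) ⋆ h)) q + (f ⋆ (g ⋆ (h ∘ suc))) q)
    ≡⟨ cong (_+_ (((f ∘ suc) ⋆ (g ⋆ h)) q))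
            (trans (sym (⋆-+ʳ f ((g ∘ suc) ⋆ h) (g ⋆ (h ∘ suc)) q))
                   (⋆-congʳ f q (λ k → sym (⋆-suc g h k)))) ⟩
  ((f ∘ suc) ⋆ (g ⋆ h)) q + (f ⋆ ((g ⋆ h) ∘ suc)) q
    ≡⟨ sym (⋆-suc f (g ⋆ h) q) ⟩
  (f ⋆ (g ⋆ h)) (suc q) ∎

⋆-identityʳ : ∀ (f : ℕ → ℤ) p → (f ⋆ δ) p ≡ f p
⋆-identityʳ f zero = unit (f 0)
  where
  unit : ∀ a → + 1 * a * + 1 ≡ a
  unit = solve-∀
⋆-identityʳ f (suc q) = begin
  (f ⋆ δ) (suc q)                             ≡⟨ ⋆-suc f δ q ⟩
  ((f ∘ suc) ⋆ δ) q + (f ⋆ (λ _ → + 0)) q     ≡⟨ cong₂ _+_ (⋆-identityʳ (f ∘ suc) q) (⋆-zeroʳ f q) ⟩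
  f (suc q) + + 0                             ≡⟨ ℤP.+-identityʳ _ ⟩
  f (suc q)                                   ∎

⋆-binomial : ∀ (x : ℤ) p → ((x ^_) ⋆ ones) p ≡ (+ 1 + x) ^ p
⋆-binomial x zero    = refl
⋆-binomial x (suc q) = begin
  ((x ^_) ⋆ ones) (suc q)                           ≡⟨ ⋆-suc (x ^_) ones q ⟩
  ((λ k → x * x ^ k) ⋆ ones) q + ((x ^_) ⋆ ones) q  ≡⟨ cong (_+ ((x ^_) ⋆ ones) q) (⋆-*ˡ x (x ^_) ones q) ⟩
  x * ((x ^_) ⋆ ones) q + ((x ^_) ⋆ ones) q         ≡⟨ cong (λ s → x * s + s) (⋆-binomial x q) ⟩
  x * (+ 1 + x) ^ q + (+ 1 + x) ^ q                 ≡⟨ factor x ((+ 1 + x) ^ q) ⟩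
  (+ 1 + x) ^ suc q                                 ∎
  where
  factor : ∀ x s → x * s + s ≡ (+ 1 + x) * s
  factor = solve-∀

0^≡δ : ∀ p → (+ 0) ^ p ≡ δ p
0^≡δ zero    = refl
0^≡δ (suc p) = refl

δ⋆ones : ∀ p → (δ ⋆ ones) p ≡ + 1
δ⋆ones p = trans (⋆-congˡ ones p (sym ∘ 0^≡δ)) (trans (⋆-binomial (+ 0) p) (ℤP.^-zeroˡ p))

sgn≡-1^ : ∀ k → sgn k ≡ (- + 1) ^ k
sgn≡-1^ zero    = refl
sgn≡-1^ (suc k) = trans (cong -_ (sgn≡-1^ k)) (sym (ℤP.-1*i≡-i _))

sgn⋆ones : ∀ p → (sgn ⋆ ones) p ≡ δ p
sgn⋆ones p = trans (⋆-congˡ ones p sgn≡-1^) (trans (⋆-binomial (- + 1) p) (0^≡δ p))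

⋆-cong-below : ∀ (K : ℕ → ℤ) {X Y : ℕ → ℤ} p → K 0 ≡ + 0 →
  (∀ {i} → i < p → X i ≡ Y i) → (K ⋆ X) p ≡ (K ⋆ Y) p
⋆-cong-below K {X} {Y} p K0≡0 X≗Y = sumTo-cong p agree
  where
  agree : ∀ k → k ≤ p → + (p C k) * K k * X (p ∸ k) ≡ + (p C k) * K k * Y (p ∸ k)
  agree zero    _    rewrite K0≡0 = refl
  agree (suc k) k<p = cong (+ (p C suc k) * K (suc k) *_) (X≗Y (ℕP.∸-monoʳ-< z<s k<p))

⋆-fixpoint-unique : ∀ (K g X Y : ℕ → ℤ) → K 0 ≡ + 0 →
  (∀ p → X p ≡ g p + (K ⋆ X) p) → (∀ p → Y p ≡ g p + (K ⋆ Y) p) → ∀ p → X p ≡ Y p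
⋆-fixpoint-unique K g X Y K0≡0 X-fix Y-fix = <-rec (λ p → X p ≡ Y p) step
  where
  step : ∀ p → (∀ {i} → i < p → X i ≡ Y i) → X p ≡ Y p
  step p X≗Y = begin
    X p               ≡⟨ X-fix p ⟩
    g p + (K ⋆ X) p   ≡⟨ cong (_+_ (g p)) (⋆-cong-below K p K0≡0 X≗Y) ⟩
    g p + (K ⋆ Y) p   ≡⟨ sym (Y-fix p) ⟩
    Y p               ∎

twiceSinh : ℕ → ℤ
twiceSinh zero          = + 0
twiceSinh (suc zero)    = + 2
twiceSinh (suc (suc k)) = twiceSinh k

twiceSinh-even : ∀ j → twiceSinh (2 ℕ.* j) ≡ + 0
twiceSinh-even zero    = refl
twiceSinh-even (suc j) = trans (cong twiceSinh (ℕP.*-suc 2 j)) (twiceSinh-even j)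

twiceSinh-odd : ∀ j → twiceSinh (suc (2 ℕ.* j)) ≡ + 2
twiceSinh-odd zero    = refl
twiceSinh-odd (suc j) = trans (cong (twiceSinh ∘ suc) (ℕP.*-suc 2 j)) (twiceSinh-odd j)

twiceSinh≡1-sgn : ∀ k → twiceSinh k ≡ + 1 - sgn k
twiceSinh≡1-sgn zero          = refl
twiceSinh≡1-sgn (suc zero)    = refl
twiceSinh≡1-sgn (suc (suc k)) =
  trans (twiceSinh≡1-sgn k) (cong (λ s → + 1 - s) (sym (ℤP.neg-involutive (sgn k))))

p≤1+2[p/2] : ∀ p → p ≤ suc (2 ℕ.* (p / 2))
p≤1+2[p/2] p = ℕP.≤-trans (ℕP.≤-reflexive (m≡m%n+[m/n]*n p 2))
  (ℕP.+-mono-≤ (ℕP.≤-pred (m%n<n p 2)) (ℕP.≤-reflexive (ℕP.*-comm (p / 2) 2)))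

recSum≡twiceSinh⋆ : ∀ p (X : ℕ → ℤ) → recSum p X ≡ (twiceSinh ⋆ X) p
recSum≡twiceSinh⋆ p X = sym (begin
  (twiceSinh ⋆ X) p
    ≡⟨ sym (sumTo-extend (suc (2 ℕ.* m)) u (p≤1+2[p/2] p) u-vanish) ⟩
  sumTo (suc (2 ℕ.* m)) u
    ≡⟨ sumTo-even-odd m u ⟩
  sumTo m (λ j → u (2 ℕ.* j)) + sumTo m (λ j → u (suc (2 ℕ.* j)))
    ≡⟨ cong (_+ sumTo m (λ j → u (suc (2 ℕ.* j))))
            (trans (sumTo-cong m (λ j _ → u-even j)) (sumTo-zero m)) ⟩
  + 0 + sumTo m (λ j → u (suc (2 ℕ.* j)))
    ≡⟨ ℤP.+-identityˡ _ ⟩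
  sumTo m (λ j → u (suc (2 ℕ.* j)))
    ≡⟨ sumTo-cong m (λ j _ → u-odd j) ⟩
  sumTo m (λ j → + 2 * (+ (p C (2 ℕ.* j ℕ.+ 1)) * X (p ∸ (2 ℕ.* j ℕ.+ 1))))
    ≡⟨ sumTo-*ˡ m (+ 2) _ ⟩
  recSum p X ∎)
  where
  m = p / 2
  u : ℕ → ℤ
  u k = + (p C k) * twiceSinh k * X (p ∸ k)
  u-vanish : ∀ k → p < k → u k ≡ + 0
  u-vanish k p<k rewrite k>n⇒nCk≡0 p<k = refl
  u-even : ∀ j → u (2 ℕ.* j) ≡ + 0
  u-even j rewrite twiceSinh-even j | ℤP.*-zeroʳ (+ (p C (2 ℕ.* j))) = refl
  u-odd : ∀ j → u (suc (2 ℕ.* j)) ≡ + 2 * (+ (p C (2 ℕ.* j ℕ.+ 1)) * X (p ∸ (2 ℕ.* j ℕ.+ 1)))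
  u-odd j rewrite twiceSinh-odd j | ℕP.+-comm (2 ℕ.* j) 1 = swap (+ (p C suc (2 ℕ.* j))) _
    where
    swap : ∀ c x → c * + 2 * x ≡ + 2 * (c * x)
    swap = solve-∀

tabulate-suc : ∀ step q → tabulate step (suc q) (suc q) ≡ step (suc q) (tabulate step q)
tabulate-suc step q with suc q ≤ᵇ q | ℕP.≤ᵇ⇒≤ (suc q) q
... | false | _    = refl
... | true  | 1+q≤q = ⊥-elim (ℕP.<-irrefl refl (1+q≤q tt))

tabulate-stable : ∀ step {q k} → k ≤ q → tabulate step q k ≡ tabulate step k k
tabulate-stable step {zero}  z≤n = refl
tabulate-stable step {suc q} {k} k≤1+q with ℕP.m≤n⇒m<n∨m≡n k≤1+q
... | inj₂ refl = refl
... | inj₁ (s≤s k≤q) with k ≤ᵇ q | ℕP.≤⇒≤ᵇ k≤q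
...   | true | _ = tabulate-stable step k≤q

tabulate-rec : ∀ (h : ℕ → ℤ → ℤ) q →
  let X = λ k → tabulate (λ p Y → h p (recSum p Y)) k k
  in X (suc q) ≡ h (suc q) ((twiceSinh ⋆ X) (suc q))
tabulate-rec h q =
  trans (tabulate-suc step q)
        (cong (h (suc q)) (trans (recSum≡twiceSinh⋆ (suc q) (tabulate step q))
          (⋆-cong-below twiceSinh (suc q) refl (λ i<1+q → tabulate-stable step (ℕP.≤-pred i<1+q)))))
  where
  step : ℕ → (ℕ → ℤ) → ℤ
  step p Y = h p (recSum p Y)

A-rec : ∀ p → A p ≡ sgn p + (twiceSinh ⋆ A) p
A-rec zero    = refl
A-rec (suc q) = tabulate-rec (λ p r → sgn p + r) q

B-rec : ∀ p → B p ≡ δ p + (twiceSinh ⋆ B) p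
B-rec zero    = refl
B-rec (suc q) = trans (tabulate-rec (λ _ r → r) q) (sym (ℤP.+-identityˡ _))

A⋆ones≡B : ∀ p → (A ⋆ ones) p ≡ B p
A⋆ones≡B = ⋆-fixpoint-unique twiceSinh δ (A ⋆ ones) B refl A⋆ones-rec B-rec
  where
  A⋆ones-rec : ∀ p → (A ⋆ ones) p ≡ δ p + (twiceSinh ⋆ (A ⋆ ones)) p
  A⋆ones-rec p = begin
    (A ⋆ ones) p                                   ≡⟨ ⋆-congˡ ones p A-rec ⟩
    ((λ k → sgn k + (twiceSinh ⋆ A) k) ⋆ ones) p   ≡⟨ ⋆-+ˡ sgn (twiceSinh ⋆ A) ones p ⟩
    (sgn ⋆ ones) p + ((twiceSinh ⋆ A) ⋆ ones) p    ≡⟨ cong₂ _+_ (sgn⋆ones p) (⋆-assoc twiceSinh A ones p) ⟩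
    δ p + (twiceSinh ⋆ (A ⋆ ones)) p               ∎

B⋆ones≡A+B-δ : ∀ p → (B ⋆ ones) p ≡ A p + (B p - δ p)
B⋆ones≡A+B-δ p =
  trans (split _ (A p)) (cong (_+_ (A p)) (⋆-fixpoint-unique twiceSinh twiceSinh Y Z refl Y-rec Z-rec p))
  where
  split : ∀ x y → x ≡ y + (x - y)
  split = solve-∀
  Y Z : ℕ → ℤ
  Y k = (B ⋆ ones) k - A k
  Z k = B k - δ k
  B⋆ones-rec : ∀ p → (B ⋆ ones) p ≡ + 1 + (twiceSinh ⋆ (B ⋆ ones)) p
  B⋆ones-rec p = begin
    (B ⋆ ones) p                                 ≡⟨ ⋆-congˡ ones p B-rec ⟩
    ((λ k → δ k + (twiceSinh ⋆ B) k) ⋆ ones) p   ≡⟨ ⋆-+ˡ δ (twiceSinh ⋆ B) ones p ⟩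
    (δ ⋆ ones) p + ((twiceSinh ⋆ B) ⋆ ones) p    ≡⟨ cong₂ _+_ (δ⋆ones p) (⋆-assoc twiceSinh B ones p) ⟩
    + 1 + (twiceSinh ⋆ (B ⋆ ones)) p             ∎
  regroup : ∀ s a t → + 1 + s - (a + t) ≡ (+ 1 - a) + (s - t)
  regroup = solve-∀
  Y-rec : ∀ p → Y p ≡ twiceSinh p + (twiceSinh ⋆ Y) p
  Y-rec p = begin
    (B ⋆ ones) p - A p
      ≡⟨ cong₂ _-_ (B⋆ones-rec p) (A-rec p) ⟩
    + 1 + (twiceSinh ⋆ (B ⋆ ones)) p - (sgn p + (twiceSinh ⋆ A) p)
      ≡⟨ regroup ((twiceSinh ⋆ (B ⋆ ones)) p) (sgn p) ((twiceSinh ⋆ A) p) ⟩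
    (+ 1 - sgn p) + ((twiceSinh ⋆ (B ⋆ ones)) p - (twiceSinh ⋆ A) p)
      ≡⟨ cong₂ _+_ (sym (twiceSinh≡1-sgn p)) (sym (⋆--ʳ twiceSinh (B ⋆ ones) A p)) ⟩
    twiceSinh p + (twiceSinh ⋆ Y) p ∎
  cancel : ∀ d s → d + s - d ≡ s
  cancel = solve-∀
  Z-rec : ∀ p → Z p ≡ twiceSinh p + (twiceSinh ⋆ Z) p
  Z-rec p = begin
    B p - δ p
      ≡⟨ cong (_- δ p) (B-rec p) ⟩
    δ p + (twiceSinh ⋆ B) p - δ p
      ≡⟨ cancel (δ p) _ ⟩
    (twiceSinh ⋆ B) p
      ≡⟨ split _ (twiceSinh p) ⟩
    twiceSinh p + ((twiceSinh ⋆ B) p - twiceSinh p)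
      ≡⟨ cong (λ t → twiceSinh p + ((twiceSinh ⋆ B) p - t)) (sym (⋆-identityʳ twiceSinh p)) ⟩
    twiceSinh p + ((twiceSinh ⋆ B) p - (twiceSinh ⋆ δ) p)
      ≡⟨ cong (_+_ (twiceSinh p)) (sym (⋆--ʳ twiceSinh B δ p)) ⟩
    twiceSinh p + (twiceSinh ⋆ Z) p ∎

pos-^ : ∀ a p → + (a ℕ.^ p) ≡ (+ a) ^ p
pos-^ a zero    = refl
pos-^ a (suc p) = trans (ℤP.pos-* a (a ℕ.^ p)) (cong (+ a *_) (pos-^ a p))

pos-^* : ∀ i p F → + (i ℕ.^ p ℕ.* F) ≡ + F * (+ i) ^ p
pos-^* i p F = trans (ℤP.pos-* (i ℕ.^ p) F) (trans (cong (_* + F) (pos-^ i p)) (ℤP.*-comm _ (+ F)))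

Cnp≡sumTo : ∀ p n → Cnp p n ≡ sumTo n (λ i → + fib (n ∸ i) * (+ i) ^ p)
Cnp≡sumTo p n = sumTo-cong n (λ i _ → pos-^* i p (fib (n ∸ i)))

Cnp-suc : ∀ p n → Cnp p (suc n) ≡ + fib (suc n) * δ p + ((λ m → Cnp m n) ⋆ ones) p
Cnp-suc p n = begin
  Cnp p (suc n)
    ≡⟨ sumTo-head n _ ⟩
  + (0 ℕ.^ p ℕ.* fib (suc n)) + sumTo n (λ i → + (suc i ℕ.^ p ℕ.* fib (n ∸ i)))
    ≡⟨ cong₂ _+_ (trans (pos-^* 0 p (fib (suc n))) (cong (+ fib (suc n) *_) (0^≡δ p)))
                 (sumTo-cong n (λ i _ → expand i)) ⟩
  + fib (suc n) * δ p + sumTo n (λ i → ((λ m → c i * (+ i) ^ m) ⋆ ones) p)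
    ≡⟨ cong (_+_ (+ fib (suc n) * δ p)) (sym (⋆-sumTo n (λ i m → c i * (+ i) ^ m) ones p)) ⟩
  + fib (suc n) * δ p + ((λ m → sumTo n (λ i → c i * (+ i) ^ m)) ⋆ ones) p
    ≡⟨ cong (_+_ (+ fib (suc n) * δ p)) (⋆-congˡ ones p (λ m → sym (Cnp≡sumTo m n))) ⟩
  + fib (suc n) * δ p + ((λ m → Cnp m n) ⋆ ones) p ∎
  where
  c : ℕ → ℤ
  c i = + fib (n ∸ i)
  expand : ∀ i → + (suc i ℕ.^ p ℕ.* fib (n ∸ i)) ≡ ((λ m → c i * (+ i) ^ m) ⋆ ones) p
  expand i = begin
    + (suc i ℕ.^ p ℕ.* fib (n ∸ i))   ≡⟨ pos-^* (suc i) p (fib (n ∸ i)) ⟩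
    c i * (+ 1 + + i) ^ p             ≡⟨ cong (c i *_) (sym (⋆-binomial (+ i) p)) ⟩
    c i * (((+ i) ^_) ⋆ ones) p       ≡⟨ sym (⋆-*ˡ (c i) ((+ i) ^_) ones p) ⟩
    ((λ m → c i * (+ i) ^ m) ⋆ ones) p ∎

Cnp-closed : ∀ n p → Cnp p n ≡ + fib n * A p + + fib (suc n) * B p - (B ⋆ ((+ n) ^_)) p
Cnp-closed zero p = begin
  Cnp p 0                             ≡⟨ cong +_ (ℕP.*-zeroʳ (0 ℕ.^ p)) ⟩
  + 0                                 ≡⟨ cancel (A p) (B p) ⟩
  + 0 * A p + + 1 * B p - B p         ≡⟨ cong (λ t → + 0 * A p + + 1 * B p - t) (sym B⋆0^≡B) ⟩
  + 0 * A p + + 1 * B p - (B ⋆ ((+ 0) ^_)) p ∎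
  where
  cancel : ∀ a b → + 0 ≡ + 0 * a + + 1 * b - b
  cancel = solve-∀
  B⋆0^≡B : (B ⋆ ((+ 0) ^_)) p ≡ B p
  B⋆0^≡B = trans (⋆-congʳ B p 0^≡δ) (⋆-identityʳ B p)
Cnp-closed (suc n) p = begin
  Cnp p (suc n)
    ≡⟨ Cnp-suc p n ⟩
  F₁ * δ p + ((λ m → Cnp m n) ⋆ ones) p
    ≡⟨ cong (_+_ (F₁ * δ p)) (trans (⋆-congˡ ones p (λ m → Cnp-closed n m)) linear) ⟩
  F₁ * δ p + (F₀ * (A ⋆ ones) p + F₁ * (B ⋆ ones) p - (Q ⋆ ones) p)
    ≡⟨ cong₂ (λ a b → F₁ * δ p + (F₀ * a + F₁ * b - (Q ⋆ ones) p)) (A⋆ones≡B p) (B⋆ones≡A+B-δ p) ⟩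
  F₁ * δ p + (F₀ * B p + F₁ * (A p + (B p - δ p)) - (Q ⋆ ones) p)
    ≡⟨ cong (λ t → F₁ * δ p + (F₀ * B p + F₁ * (A p + (B p - δ p)) - t)) Q⋆ones ⟩
  F₁ * δ p + (F₀ * B p + F₁ * (A p + (B p - δ p)) - (B ⋆ ((+ suc n) ^_)) p)
    ≡⟨ collect F₀ F₁ (A p) (B p) (δ p) ((B ⋆ ((+ suc n) ^_)) p) ⟩
  F₁ * A p + (F₁ + F₀) * B p - (B ⋆ ((+ suc n) ^_)) p ∎
  where
  F₀ = + fib n
  F₁ = + fib (suc n)
  Q : ℕ → ℤ
  Q = B ⋆ ((+ n) ^_)
  linear : ((λ m → F₀ * A m + F₁ * B m - Q m) ⋆ ones) p
           ≡ F₀ * (A ⋆ ones) p + F₁ * (B ⋆ ones) p - (Q ⋆ ones) p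
  linear =
    trans (⋆--ˡ (λ m → F₀ * A m + F₁ * B m) Q ones p)
          (cong (_- (Q ⋆ ones) p)
                (trans (⋆-+ˡ (λ m → F₀ * A m) (λ m → F₁ * B m) ones p)
                       (cong₂ _+_ (⋆-*ˡ F₀ A ones p) (⋆-*ˡ F₁ B ones p))))
  Q⋆ones : (Q ⋆ ones) p ≡ (B ⋆ ((+ suc n) ^_)) p
  Q⋆ones = trans (⋆-assoc B ((+ n) ^_) ones p) (⋆-congʳ B p (⋆-binomial (+ n)))
  collect : ∀ f₀ f₁ a b d s →
    f₁ * d + (f₀ * b + f₁ * (a + (b - d)) - s) ≡ f₁ * a + (f₁ + f₀) * b - s
  collect = solve-∀

theorem2 : (p n : ℕ) →
    Cnp p n ≡ A p * + fib n + B p * + fib (suc n)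
              - sumTo p (λ k → + (p C k) * B k * (+ n) ^ (p ∸ k))
theorem2 p n =
  trans (Cnp-closed n p)
        (cong₂ (λ a b → a + b - (B ⋆ ((+ n) ^_)) p) (ℤP.*-comm _ (A p)) (ℤP.*-comm _ (B p)))
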